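{- For any $[k,d,n]$ PSF family, $d\le\log_2\sum_{i=k}^{n}\binom{n}{i}$.
   Context: An ordered set is a finite sequence of distinct elements of a ground set. A family $\mathcal F$ of ordered sets is prefix set-free (PSF) if for any two distinct members $A,B\in\mathcal F$, no prefix of $A$ equals $B$ as an (unordered) set. If the ground set has $n$ elements, every member of $\mathcal F$ has length at least $k$, and $|\mathcal F|\ge 2^d$, then $\mathcal F$ is called a $[k,d,n]$ PSF family. -}

module Defs where

open import Data.Nat using (ℕ; zero; suc; _+_; _∸_; _^_; _≤_)
open import Data.Nat.Combinatorics using (_C_)
open import Data.Fin using (Fin)
open import Data.List using (List; length; take; map; upTo)
open import Data.Nat.ListAction using (sum)
open import Data.List.Membership.Propositional using (_∈_)
open import Data.List.Relation.Unary.Unique.Propositional using (Unique)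
open import Data.List.Relation.Unary.All using (All)
open import Data.Product using (_×_)
open import Relation.Binary.PropositionalEquality using (_≡_; _≢_)
open import Relation.Nullary using (¬_)

OrderedSet : ℕ → Set
OrderedSet n = List (Fin n)

IsOrderedSet : ∀ {n} → OrderedSet n → Set
IsOrderedSet A = Unique A

SameSet : ∀ {n} → List (Fin n) → List (Fin n) → Set
SameSet P B = ∀ x → (x ∈ P → x ∈ B) × (x ∈ B → x ∈ P)

-- A family of ordered sets is given as a list without repetitions;
-- its size is its length.
PSF : ∀ {n} → List (OrderedSet n) → Set
PSF F = ∀ A B → A ∈ F → B ∈ F → A ≢ B → ∀ j → ¬ SameSet (take j A) B

IsKDNPSF : (k d n : ℕ) → List (OrderedSet n) → Set
IsKDNPSF k d n F =
  Unique F × All IsOrderedSet F × PSF F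
  × All (λ A → k ≤ length A) F × 2 ^ d ≤ length F

-- Σ_{i=k}^{n} (n choose i)   (empty sum = 0 if k > n)
binomTail : ℕ → ℕ → ℕ
binomTail k n = sum (map (λ i → n C (k + i)) (upTo (suc n ∸ k)))

-- Taking the full prefix shows that distinct members of a PSF family are
-- distinct as sets, so a [k,d,n] family injects into the subsets of an
-- n-set of size at least k. These are counted by induction on n: split
-- the family according to whether it contains the element 0, and delete
-- that element; the two halves are families of distinct sets on n-1 points
-- of sizes at least k and k-1, matching Pascal's rule for the tail sum.
module Submission where

open import Defs
open import Data.Nat using (ℕ; zero; suc; _+_; _∸_; _^_; _≤_; _<_; z≤n; s≤s)
open import Data.Nat.Properties
open import Data.Nat.Combinatorics using (_C_; k>n⇒nCk≡0; nCk+nC[k+1]≡[n+1]C[k+1])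
open import Data.Nat.ListAction using (sum)
open import Algebra.Properties.CommutativeSemigroup +-commutativeSemigroup
  using () renaming (interchange to +-interchange)
open import Data.Fin using (Fin; zero; suc)
import Data.Fin as Fin
open import Data.List using (List; []; _∷_; length; map; filter; applyUpTo)
open import Data.List.Properties using (length-map; take-all)
open import Data.List.Relation.Unary.All using (All; []; _∷_)
import Data.List.Relation.Unary.All as All
import Data.List.Relation.Unary.All.Properties as All
open import Data.List.Relation.Unary.AllPairs using (AllPairs; []; _∷_)
import Data.List.Relation.Unary.AllPairs.Properties as AllPairs
open import Data.List.Relation.Unary.Any using (here; there)
open import Data.List.Membership.Propositional using (_∈_; _∉_)
import Data.List.Membership.DecPropositional as DecMembership
open import Data.List.Relation.Unary.Unique.Propositional using (Unique)
open import Data.Product using (_×_; _,_; proj₁; proj₂)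
open import Data.Empty using (⊥-elim)
open import Relation.Binary.PropositionalEquality
open import Relation.Nullary using (¬_; yes; no; Dec)
open import Relation.Unary using (Pred; Decidable)
open import Relation.Unary.Properties using (∁?)
open import Function using (id; const; _∘_)

module _ {a p} {A : Set a} {P : Pred A p} (P? : Decidable P) where

  length-filter-∁ : ∀ xs → length xs ≡ length (filter P? xs) + length (filter (∁? P?) xs)
  length-filter-∁ [] = refl
  length-filter-∁ (x ∷ xs) with P? x
  ... | yes _ = cong suc (length-filter-∁ xs)
  ... | no _ = trans (cong suc (length-filter-∁ xs)) (sym (+-suc _ _))

mapAllPairsOn : ∀ {a p r s} {A : Set a} {P : Pred A p} {R : A → A → Set r} {S : A → A → Set s} →
  (∀ {x y} → P x → P y → R x y → S x y) → ∀ {xs} → All P xs → AllPairs R xs → AllPairs S xs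
mapAllPairsOn f [] [] = []
mapAllPairsOn f (px ∷ pxs) (rx ∷ rxs) =
  All.zipWith (λ (py , rxy) → f px py rxy) (pxs , rx) ∷ mapAllPairsOn f pxs rxs

binomSum : ℕ → ℕ → ℕ → ℕ
binomSum n k zero = 0
binomSum n k (suc N) = n C k + binomSum n (suc k) N

binomSum-vanishes : ∀ {n k} N → n < k → binomSum n k N ≡ 0
binomSum-vanishes zero _ = refl
binomSum-vanishes (suc N) n<k rewrite k>n⇒nCk≡0 n<k = binomSum-vanishes N (m<n⇒m<1+n n<k)

binomSum-saturates : ∀ {n k M N} → n < k + M → M ≤ N → binomSum n k M ≡ binomSum n k N
binomSum-saturates {n} {k} {zero} {N} n<k+0 _ =
  sym (binomSum-vanishes N (subst (n <_) (+-identityʳ k) n<k+0))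
binomSum-saturates {n} {k} {suc M} {suc N} n<k+1+M (s≤s M≤N) =
  cong (n C k +_) (binomSum-saturates (subst (n <_) (+-suc k M) n<k+1+M) M≤N)

binomSum-pascal : ∀ n k N → binomSum (suc n) (suc k) N ≡ binomSum n k N + binomSum n (suc k) N
binomSum-pascal n k zero = refl
binomSum-pascal n k (suc N) = begin
  suc n C suc k + binomSum (suc n) (suc (suc k)) N
    ≡⟨ cong₂ _+_ (sym (nCk+nC[k+1]≡[n+1]C[k+1] n k)) (binomSum-pascal n (suc k) N) ⟩
  (n C k + n C suc k) + (binomSum n (suc k) N + binomSum n (suc (suc k)) N)
    ≡⟨ +-interchange (n C k) (n C suc k) _ _ ⟩
  (n C k + binomSum n (suc k) N) + (n C suc k + binomSum n (suc (suc k)) N) ∎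
  where open ≡-Reasoning

-- The leading terms suc n C 0 and n C 0 both compute to 1.
binomSum-pascal₀ : ∀ n N → binomSum (suc n) 0 (suc N) ≡ binomSum n 0 N + binomSum n 0 (suc N)
binomSum-pascal₀ n N =
  trans (cong suc (binomSum-pascal n 0 N)) (sym (+-suc (binomSum n 0 N) (binomSum n 1 N)))

binomTail≡binomSum : ∀ k n → binomTail k n ≡ binomSum n k (suc n ∸ k)
binomTail≡binomSum k n = sum-map-applyUpTo k id (suc n ∸ k) (λ _ → refl)
  where
  g : ℕ → ℕ
  g i = n C (k + i)
  sum-map-applyUpTo : ∀ k′ f N → (∀ i → g (f i) ≡ n C (k′ + i)) →
    sum (map g (applyUpTo f N)) ≡ binomSum n k′ N
  sum-map-applyUpTo k′ f zero _ = refl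
  sum-map-applyUpTo k′ f (suc N) gf≗ =
    cong₂ _+_ (trans (gf≗ 0) (cong (n C_) (+-identityʳ k′)))
      (sum-map-applyUpTo (suc k′) (f ∘ suc) N (λ i → trans (gf≗ (suc i)) (cong (n C_) (+-suc k′ i))))

binomTail-suc : ∀ k n → binomTail k (suc n) ≡ binomTail k n + binomTail (k ∸ 1) n
binomTail-suc zero n = begin
  binomTail 0 (suc n)                          ≡⟨ binomTail≡binomSum 0 (suc n) ⟩
  binomSum (suc n) 0 (suc (suc n))             ≡⟨ binomSum-pascal₀ n (suc n) ⟩
  binomSum n 0 (suc n) + binomSum n 0 (suc (suc n))
    ≡⟨ cong (binomSum n 0 (suc n) +_) (sym (binomSum-saturates {n} {0} ≤-refl (n≤1+n (suc n)))) ⟩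
  binomSum n 0 (suc n) + binomSum n 0 (suc n)  ≡⟨ sym (cong₂ _+_ (binomTail≡binomSum 0 n) (binomTail≡binomSum 0 n)) ⟩
  binomTail 0 n + binomTail 0 n                ∎
  where open ≡-Reasoning
binomTail-suc (suc k) n = begin
  binomTail (suc k) (suc n)                                  ≡⟨ binomTail≡binomSum (suc k) (suc n) ⟩
  binomSum (suc n) (suc k) (suc n ∸ k)                       ≡⟨ binomSum-pascal n k (suc n ∸ k) ⟩
  binomSum n k (suc n ∸ k) + binomSum n (suc k) (suc n ∸ k)  ≡⟨ +-comm (binomSum n k (suc n ∸ k)) _ ⟩
  binomSum n (suc k) (suc n ∸ k) + binomSum n k (suc n ∸ k)
    ≡⟨ cong (_+ binomSum n k (suc n ∸ k))
         (sym (binomSum-saturates (s≤s (m≤n+m∸n n k)) (∸-monoˡ-≤ k (n≤1+n n)))) ⟩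
  binomSum n (suc k) (n ∸ k) + binomSum n k (suc n ∸ k)
    ≡⟨ sym (cong₂ _+_ (binomTail≡binomSum (suc k) n) (binomTail≡binomSum k n)) ⟩
  binomTail (suc k) n + binomTail k n                        ∎
  where open ≡-Reasoning

AtLeast : ∀ {n} → ℕ → List (Fin n) → Set
AtLeast k A = Unique A × k ≤ length A

DistinctSets : ∀ {n} → List (List (Fin n)) → Set
DistinctSets = AllPairs (λ A B → ¬ SameSet A B)

dropZero : ∀ {n} → List (Fin (suc n)) → List (Fin n)
dropZero [] = []
dropZero (zero ∷ xs) = dropZero xs
dropZero (suc x ∷ xs) = x ∷ dropZero xs

module _ {n : ℕ} where

  suc∈⇒∈dropZero : ∀ {y : Fin n} A → suc y ∈ A → y ∈ dropZero A
  suc∈⇒∈dropZero (zero ∷ xs) (there p) = suc∈⇒∈dropZero xs p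
  suc∈⇒∈dropZero (suc x ∷ xs) (here refl) = here refl
  suc∈⇒∈dropZero (suc x ∷ xs) (there p) = there (suc∈⇒∈dropZero xs p)

  ∈dropZero⇒suc∈ : ∀ {y : Fin n} A → y ∈ dropZero A → suc y ∈ A
  ∈dropZero⇒suc∈ (zero ∷ xs) p = there (∈dropZero⇒suc∈ xs p)
  ∈dropZero⇒suc∈ (suc x ∷ xs) (here refl) = here refl
  ∈dropZero⇒suc∈ (suc x ∷ xs) (there p) = there (∈dropZero⇒suc∈ xs p)

  dropZero-unique : (A : List (Fin (suc n))) → Unique A → Unique (dropZero A)
  dropZero-unique [] _ = []
  dropZero-unique (zero ∷ xs) (_ ∷ u) = dropZero-unique xs u
  dropZero-unique (suc x ∷ xs) (x∉xs ∷ u) = fresh xs x∉xs ∷ dropZero-unique xs u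
    where
    fresh : ∀ ys → All (suc x ≢_) ys → All (x ≢_) (dropZero ys)
    fresh [] [] = []
    fresh (zero ∷ ys) (_ ∷ ne) = fresh ys ne
    fresh (suc y ∷ ys) (x≢y ∷ ne) = (λ x≡y → x≢y (cong suc x≡y)) ∷ fresh ys ne

  length-dropZero-∉ : (A : List (Fin (suc n))) → zero ∉ A → length (dropZero A) ≡ length A
  length-dropZero-∉ [] _ = refl
  length-dropZero-∉ (zero ∷ xs) 0∉A = ⊥-elim (0∉A (here refl))
  length-dropZero-∉ (suc x ∷ xs) 0∉A = cong suc (length-dropZero-∉ xs (0∉A ∘ there))

  length-dropZero-unique : (A : List (Fin (suc n))) → Unique A → length A ≤ suc (length (dropZero A))
  length-dropZero-unique [] _ = z≤n
  length-dropZero-unique (zero ∷ xs) (0∉xs ∷ _) =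
    s≤s (≤-reflexive (sym (length-dropZero-∉ xs (All.All¬⇒¬Any 0∉xs))))
  length-dropZero-unique (suc x ∷ xs) (_ ∷ u) = s≤s (length-dropZero-unique xs u)

  dropZero-atLeast-∉ : ∀ {k} {A : List (Fin (suc n))} → zero ∉ A → AtLeast k A → AtLeast k (dropZero A)
  dropZero-atLeast-∉ {k} {A} 0∉A (unique , k≤∣A∣) =
    dropZero-unique A unique , subst (k ≤_) (sym (length-dropZero-∉ A 0∉A)) k≤∣A∣

  dropZero-atLeast : ∀ {k} {A : List (Fin (suc n))} → AtLeast k A → AtLeast (k ∸ 1) (dropZero A)
  dropZero-atLeast {k} {A} (unique , k≤∣A∣) =
    dropZero-unique A unique , ∸-monoˡ-≤ 1 (≤-trans k≤∣A∣ (length-dropZero-unique A unique))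

  dropZero-reflects-SameSet : ∀ (A B : List (Fin (suc n))) → (zero ∈ A → zero ∈ B) → (zero ∈ B → zero ∈ A) →
    SameSet (dropZero A) (dropZero B) → SameSet A B
  dropZero-reflects-SameSet A B A⇒B B⇒A same zero = A⇒B , B⇒A
  dropZero-reflects-SameSet A B A⇒B B⇒A same (suc y) =
    (λ p → ∈dropZero⇒suc∈ B (proj₁ (same y) (suc∈⇒∈dropZero A p))) ,
    (λ p → ∈dropZero⇒suc∈ A (proj₂ (same y) (suc∈⇒∈dropZero B p)))

distinctSets-length≤binomTail : ∀ n k (L : List (List (Fin n))) →
  All (AtLeast k) L → DistinctSets L → length L ≤ binomTail k n
distinctSets-length≤binomTail zero k [] _ _ = z≤n
distinctSets-length≤binomTail zero k ((() ∷ _) ∷ _) _ _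
distinctSets-length≤binomTail zero zero ([] ∷ []) _ _ = ≤-refl
distinctSets-length≤binomTail zero (suc k) ([] ∷ []) ((_ , ()) ∷ _) _
distinctSets-length≤binomTail zero k ([] ∷ [] ∷ _) _ ((A≉B ∷ _) ∷ _) = ⊥-elim (A≉B (λ _ → id , id))
distinctSets-length≤binomTail zero k ([] ∷ (() ∷ _) ∷ _) _ _
distinctSets-length≤binomTail (suc n) k L large distinct = begin
  length L                                            ≡⟨ length-filter-∁ 0∈? L ⟩
  length L₀ + length L₁                               ≡⟨ sym (cong₂ _+_ (length-map dropZero L₀) (length-map dropZero L₁)) ⟩
  length (map dropZero L₀) + length (map dropZero L₁)
    ≤⟨ +-mono-≤ (distinctSets-length≤binomTail n (k ∸ 1) (map dropZero L₀) large₀ distinct₀)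
                (distinctSets-length≤binomTail n k (map dropZero L₁) large₁ distinct₁) ⟩
  binomTail (k ∸ 1) n + binomTail k n                 ≡⟨ +-comm (binomTail (k ∸ 1) n) (binomTail k n) ⟩
  binomTail k n + binomTail (k ∸ 1) n                 ≡⟨ sym (binomTail-suc k n) ⟩
  binomTail k (suc n)                                 ∎
  where
  open ≤-Reasoning
  0∈? : (A : List (Fin (suc n))) → Dec (zero ∈ A)
  0∈? = DecMembership._∈?_ Fin._≟_ zero
  L₀ L₁ : List (List (Fin (suc n)))
  L₀ = filter 0∈? L
  L₁ = filter (∁? 0∈?) L
  all-0∈ : All (zero ∈_) L₀
  all-0∈ = All.all-filter 0∈? L
  all-0∉ : All (zero ∉_) L₁
  all-0∉ = All.all-filter (∁? 0∈?) L
  large₀ : All (AtLeast (k ∸ 1)) (map dropZero L₀)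
  large₀ = All.map⁺ (All.map dropZero-atLeast (All.filter⁺ 0∈? large))
  large₁ : All (AtLeast k) (map dropZero L₁)
  large₁ = All.map⁺ (All.zipWith (λ (0∉A , A-large) → dropZero-atLeast-∉ 0∉A A-large)
                                 (all-0∉ , All.filter⁺ (∁? 0∈?) large))
  distinct₀ : DistinctSets (map dropZero L₀)
  distinct₀ = AllPairs.map⁺ (mapAllPairsOn
    (λ 0∈A 0∈B A≉B → A≉B ∘ dropZero-reflects-SameSet _ _ (const 0∈B) (const 0∈A))
    all-0∈ (AllPairs.filter⁺ 0∈? distinct))
  distinct₁ : DistinctSets (map dropZero L₁)
  distinct₁ = AllPairs.map⁺ (mapAllPairsOn
    (λ 0∉A 0∉B A≉B → A≉B ∘ dropZero-reflects-SameSet _ _ (⊥-elim ∘ 0∉A) (⊥-elim ∘ 0∉B))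
    all-0∉ (AllPairs.filter⁺ (∁? 0∈?) distinct))

psf⇒distinctSets : ∀ {n} {F : List (OrderedSet n)} → PSF F → Unique F → DistinctSets F
psf⇒distinctSets {F = F} psf unique = mapAllPairsOn fullPrefix (All.tabulate id) unique
  where
  fullPrefix : ∀ {A B} → A ∈ F → B ∈ F → A ≢ B → ¬ SameSet A B
  fullPrefix {A} {B} A∈F B∈F A≢B A≈B =
    psf A B A∈F B∈F A≢B (length A) (subst (λ P → SameSet P B) (sym (take-all (length A) A ≤-refl)) A≈B)

claim4 : (k d n : ℕ) (F : List (OrderedSet n)) →
    IsKDNPSF k d n F → 2 ^ d ≤ binomTail k n
claim4 k d n F (unique , ordered , psf , long , large) =
  ≤-trans large (distinctSets-length≤binomTail n k F (All.zip (ordered , long)) (psf⇒distinctSets psf unique))
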